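{- Let $F$, $G$, $H$ be graphs. Let $(G,(F_g)_{g\in V(G)})$ be a $G$-decomposition of $F$ of width $G\text{ - }\mathsf{wd}(F)$ and $(H,(G_h)_{h\in V(H)})$ an $H$-decomposition of $G$ of width $H\text{ - }\mathsf{wd}(G)$. For each $h\in V(H)$ let $\tilde F_h:=\bigcup_{g\in G_h}F_g$. Then (a) $(H,(\tilde F_h)_{h\in V(H)})$ is an $H$-decomposition of $F$; and (b) for each $h\in V(H)$, $|\tilde F_h|\leq G\text{ - }\mathsf{wd}(F)\cdot H\text{ - }\mathsf{wd}(G)$.
   Context: All graphs are simple, undirected and finite. For graphs $X$ and $Y$, a $Y$-decomposition of $X$ is a pair $(Y,(X_y)_{y\in V(Y)})$ with $X_y\subseteq V(X)$ such that: (D1) every vertex of $X$ lies in some $X_y$; (D2) for every edge $xx'$ of $X$ there is a vertex $y$ of $Y$ with $\{x,x'\}\subseteq X_y$, or an edge $yy'$ of $Y$ with $x\in X_y$ and $x'\in X_{y'}$; (D3) for every vertex $x$ of $X$, $\{y\in V(Y): x\in X_y\}$ induces a connected subgraph of $Y$. The width is $\max_y|X_y|$, and $Y\text{ - }\mathsf{wd}(X)$ is the minimum width of a $Y$-decomposition of $X$. -}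

module Defs where

open import Data.Nat using (ℕ; _⊔_; _≤_)
open import Data.Fin using (Fin)
open import Data.Fin.Subset using (Subset; _∈_; ⋃; ∣_∣)
open import Data.Fin.Subset.Properties using (_∈?_)
open import Data.Bool using (Bool; true; false)
open import Data.List using (List; map; foldr; filter; allFin)
open import Data.Product using (Σ; ∃; ∃₂; _×_; _,_)
open import Data.Sum using (_⊎_)
open import Relation.Binary.PropositionalEquality using (_≡_)

record Graph : Set where
  field
    size   : ℕ
    adj    : Fin size → Fin size → Bool
    sym    : ∀ u v → adj u v ≡ adj v u
    irrefl : ∀ v → adj v v ≡ false

open Graph public

V : Graph → Set
V X = Fin (size X)

data WalkIn (Y : Graph) (P : V Y → Set) : V Y → V Y → Set where
  stay : ∀ {y} → P y → WalkIn Y P y y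
  step : ∀ {y z y'} → P y → adj Y y z ≡ true → WalkIn Y P z y' → WalkIn Y P y y'

InducesConnected : (Y : Graph) → (V Y → Set) → Set
InducesConnected Y P = ∀ y y' → P y → P y' → WalkIn Y P y y'

record IsDecomposition (Y X : Graph) (bags : V Y → Subset (size X)) : Set where
  field
    D1 : ∀ (x : V X) → ∃ λ (y : V Y) → x ∈ bags y
    D2 : ∀ (x x' : V X) → adj X x x' ≡ true →
           (∃ λ (y : V Y) → x ∈ bags y × x' ∈ bags y)
           ⊎ (∃₂ λ (y y' : V Y) → adj Y y y' ≡ true × x ∈ bags y × x' ∈ bags y')
    D3 : ∀ (x : V X) → InducesConnected Y (λ y → x ∈ bags y)

-- width = max_y |X_y|  (0 if Y has no vertices)
width : (Y X : Graph) → (V Y → Subset (size X)) → ℕ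
width Y X bags = foldr _⊔_ 0 (map (λ y → ∣ bags y ∣) (allFin (size Y)))

IsDecompWidth : (Y X : Graph) → ℕ → Set
IsDecompWidth Y X k =
  (Σ (V Y → Subset (size X)) λ bags → IsDecomposition Y X bags × width Y X bags ≡ k)
  × (∀ bags → IsDecomposition Y X bags → k ≤ width Y X bags)

composeBags : (F G H : Graph) → (V G → Subset (size F)) → (V H → Subset (size G))
            → V H → Subset (size F)
composeBags F G H Fb Gb h = ⋃ (map Fb (filter (_∈? Gb h) (allFin (size G))))

-- The bag of h in the composed decomposition is the union of the F-bags F_g over the
-- at most H-wd(G) vertices g ∈ G_h, each of size at most G-wd(F); this gives (b).
-- For (a), the bags containing a vertex x of F are exactly the H-bags meeting the
-- connected set {g | x ∈ F_g}. A walk in that set lifts to H: the H-bags containing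
-- a single g are connected, and the H-bags of adjacent g, g' share a bag or contain
-- adjacent bags.
module Submission where

open import Defs
open import Data.Nat using (ℕ; _≤_; _*_; _+_; _⊔_; suc; z≤n; s≤s)
open import Data.Nat.Properties
  using (≤-trans; ≤-reflexive; +-mono-≤; +-monoʳ-≤; +-suc; *-monoˡ-≤; *-comm; n≤1+n; m≤m⊔n; m≤n⊔m; module ≤-Reasoning)
open import Data.Fin as Fin using (Fin)
open import Data.Fin.Subset using (Subset; ∣_∣; _∪_; ⋃; inside; outside) renaming (_∈_ to _∈ₛ_)
open import Data.Fin.Subset.Properties using (_∈?_; x∈p∪q⁺; x∈p∪q⁻; ∉⊥; ∣⊥∣≡0)
open import Data.Vec using ([]; _∷_)
open import Data.List using (List; []; _∷_; map; filter; allFin; tabulate; foldr; length)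
open import Data.List.Properties using (map-tabulate; length-map)
open import Data.List.Membership.Propositional using (_∈_)
open import Data.List.Membership.Propositional.Properties using (∈-map⁺; ∈-map⁻; ∈-filter⁺; ∈-filter⁻; ∈-allFin)
open import Data.List.Relation.Unary.Any using (here; there)
open import Data.Bool using (true; false)
open import Data.Product using (_×_; _,_; ∃; proj₂)
open import Data.Sum using (inj₁; inj₂)
open import Data.Empty using (⊥-elim)
open import Function using (id; _∘_)
open import Relation.Nullary using (does)
open import Level using (0ℓ)
open import Relation.Unary using (Pred; Decidable)
open import Relation.Binary.PropositionalEquality as ≡ using (_≡_; refl; cong; module ≡-Reasoning)

private
  variable
    A B : Set
    m n : ℕ

filter-map : ∀ (f : A → B) {P : Pred B 0ℓ} {Q : Pred A 0ℓ} {P? : Decidable P} {Q? : Decidable Q} →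
             (∀ a → does (P? (f a)) ≡ does (Q? a)) →
             ∀ xs → filter P? (map f xs) ≡ map f (filter Q? xs)
filter-map f agree [] = refl
filter-map f {Q? = Q?} agree (a ∷ xs) rewrite agree a with does (Q? a)
... | true  = cong (f a ∷_) (filter-map f agree xs)
... | false = filter-map f agree xs

-- allFin (suc n) unfolds to zero ∷ tabulate suc, and does (suc i ∈? x ∷ s) to does (i ∈? s).
length-filter-∈?-allFin : (s : Subset n) → length (filter (_∈? s) (allFin n)) ≡ ∣ s ∣
length-filter-∈?-tail : ∀ x (s : Subset n) → length (filter (_∈? (x ∷ s)) (tabulate Fin.suc)) ≡ ∣ s ∣

length-filter-∈?-allFin []            = refl
length-filter-∈?-allFin (inside ∷ s)  = cong suc (length-filter-∈?-tail inside s)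
length-filter-∈?-allFin (outside ∷ s) = length-filter-∈?-tail outside s

length-filter-∈?-tail {n} x s = begin
  length (filter (_∈? (x ∷ s)) (tabulate Fin.suc))       ≡⟨ cong (length ∘ filter (_∈? (x ∷ s))) (≡.sym (map-tabulate id Fin.suc)) ⟩
  length (filter (_∈? (x ∷ s)) (map Fin.suc (allFin n))) ≡⟨ cong length (filter-map Fin.suc (λ _ → refl) (allFin n)) ⟩
  length (map Fin.suc (filter (_∈? s) (allFin n)))       ≡⟨ length-map Fin.suc (filter (_∈? s) (allFin n)) ⟩
  length (filter (_∈? s) (allFin n))                     ≡⟨ length-filter-∈?-allFin s ⟩
  ∣ s ∣                                                  ∎
  where open ≡-Reasoning

∣p∪q∣≤∣p∣+∣q∣ : (p q : Subset n) → ∣ p ∪ q ∣ ≤ ∣ p ∣ + ∣ q ∣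
∣p∪q∣≤∣p∣+∣q∣ []            []            = z≤n
∣p∪q∣≤∣p∣+∣q∣ (inside ∷ p)  (inside ∷ q)  = s≤s (≤-trans (∣p∪q∣≤∣p∣+∣q∣ p q) (+-monoʳ-≤ ∣ p ∣ (n≤1+n ∣ q ∣)))
∣p∪q∣≤∣p∣+∣q∣ (inside ∷ p)  (outside ∷ q) = s≤s (∣p∪q∣≤∣p∣+∣q∣ p q)
∣p∪q∣≤∣p∣+∣q∣ (outside ∷ p) (inside ∷ q)  = ≤-trans (s≤s (∣p∪q∣≤∣p∣+∣q∣ p q)) (≤-reflexive (≡.sym (+-suc ∣ p ∣ ∣ q ∣)))
∣p∪q∣≤∣p∣+∣q∣ (outside ∷ p) (outside ∷ q) = ∣p∪q∣≤∣p∣+∣q∣ p q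

∣⋃-map∣≤length* : ∀ {w} (f : A → Subset m) → (∀ a → ∣ f a ∣ ≤ w) →
                  ∀ xs → ∣ ⋃ (map f xs) ∣ ≤ length xs * w
∣⋃-map∣≤length* {m = m} f ∣f∣≤w []       = ≤-reflexive (∣⊥∣≡0 m)
∣⋃-map∣≤length*         f ∣f∣≤w (a ∷ xs) =
  ≤-trans (∣p∪q∣≤∣p∣+∣q∣ (f a) _) (+-mono-≤ (∣f∣≤w a) (∣⋃-map∣≤length* f ∣f∣≤w xs))

∈-⋃⁺ : ∀ {x : Fin n} {p ps} → p ∈ ps → x ∈ₛ p → x ∈ₛ ⋃ ps
∈-⋃⁺ (here refl) x∈p = x∈p∪q⁺ (inj₁ x∈p)
∈-⋃⁺ (there p∈ps) x∈p = x∈p∪q⁺ (inj₂ (∈-⋃⁺ p∈ps x∈p))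

∈-⋃⁻ : ∀ {x : Fin n} ps → x ∈ₛ ⋃ ps → ∃ λ p → p ∈ ps × x ∈ₛ p
∈-⋃⁻ []       x∈⋃ = ⊥-elim (∉⊥ x∈⋃)
∈-⋃⁻ (p ∷ ps) x∈⋃ with x∈p∪q⁻ p (⋃ ps) x∈⋃
... | inj₁ x∈p = p , here refl , x∈p
... | inj₂ x∈⋃ps with ∈-⋃⁻ ps x∈⋃ps
...   | q , q∈ps , x∈q = q , there q∈ps , x∈q

f∈≤foldr-⊔ : ∀ (f : A → ℕ) {a xs} → a ∈ xs → f a ≤ foldr _⊔_ 0 (map f xs)
f∈≤foldr-⊔ f (here refl)  = m≤m⊔n _ _
f∈≤foldr-⊔ f (there a∈xs) = ≤-trans (f∈≤foldr-⊔ f a∈xs) (m≤n⊔m _ _)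

∣bag∣≤width : ∀ Y X (bags : V Y → Subset (size X)) y → ∣ bags y ∣ ≤ width Y X bags
∣bag∣≤width Y X bags y = f∈≤foldr-⊔ (λ y → ∣ bags y ∣) (∈-allFin y)

module _ {Y : Graph} where

  WalkIn-++ : ∀ {P a b c} → WalkIn Y P a b → WalkIn Y P b c → WalkIn Y P a c
  WalkIn-++ (stay _)     w′ = w′
  WalkIn-++ (step p e w) w′ = step p e (WalkIn-++ w w′)

  WalkIn-map : ∀ {P Q : V Y → Set} → (∀ {y} → P y → Q y) → ∀ {a b} → WalkIn Y P a b → WalkIn Y Q a b
  WalkIn-map f (stay p)     = stay (f p)
  WalkIn-map f (step p e w) = step (f p) e (WalkIn-map f w)

Meets : (Fin n → Subset m) → (Fin m → Set) → Fin n → Set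
Meets Gb P h = ∃ λ g → g ∈ₛ Gb h × P g

module _ {G H : Graph} {Gb : V H → Subset (size G)} (isDecomp : IsDecomposition H G Gb) where
  open IsDecomposition isDecomp

  WalkIn-Meets : ∀ {P g h h′} → P g → g ∈ₛ Gb h → g ∈ₛ Gb h′ → WalkIn H (Meets Gb P) h h′
  WalkIn-Meets {g = g} {h} {h′} p g∈h g∈h′ = WalkIn-map (λ g∈ → g , g∈ , p) (D3 g h h′ g∈h g∈h′)

  WalkIn-lift : ∀ {P g g′ h h′} → WalkIn G P g g′ → g ∈ₛ Gb h → g′ ∈ₛ Gb h′ → WalkIn H (Meets Gb P) h h′
  WalkIn-lift (stay p) g∈h g∈h′ = WalkIn-Meets p g∈h g∈h′
  WalkIn-lift (step {g} {g₁} p g~g₁ w) g∈h g′∈h′ with D2 g g₁ g~g₁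
  ... | inj₁ (h₁ , g∈h₁ , g₁∈h₁) =
    WalkIn-++ (WalkIn-Meets p g∈h g∈h₁) (WalkIn-lift w g₁∈h₁ g′∈h′)
  ... | inj₂ (h₁ , h₂ , h₁~h₂ , g∈h₁ , g₁∈h₂) =
    WalkIn-++ (WalkIn-Meets p g∈h g∈h₁) (step (g , g∈h₁ , p) h₁~h₂ (WalkIn-lift w g₁∈h₂ g′∈h′))

  InducesConnected-Meets : ∀ {P} → InducesConnected G P → InducesConnected H (Meets Gb P)
  InducesConnected-Meets connected h h′ (g , g∈h , p) (g′ , g′∈h′ , p′) =
    WalkIn-lift (connected g g′ p p′) g∈h g′∈h′

module _ (F G H : Graph) (Fb : V G → Subset (size F)) (Gb : V H → Subset (size G)) where
  open IsDecomposition

  ∈-composeBags⁺ : ∀ {x h} → Meets Gb (λ g → x ∈ₛ Fb g) h → x ∈ₛ composeBags F G H Fb Gb h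
  ∈-composeBags⁺ {h = h} (g , g∈h , x∈g) =
    ∈-⋃⁺ (∈-map⁺ Fb (∈-filter⁺ (_∈? Gb h) (∈-allFin g) g∈h)) x∈g

  ∈-composeBags⁻ : ∀ {x h} → x ∈ₛ composeBags F G H Fb Gb h → Meets Gb (λ g → x ∈ₛ Fb g) h
  ∈-composeBags⁻ {h = h} x∈ with ∈-⋃⁻ (map Fb (filter (_∈? Gb h) (allFin (size G)))) x∈
  ... | p , p∈ , x∈p with ∈-map⁻ Fb p∈
  ...   | g , g∈ , refl = g , proj₂ (∈-filter⁻ (_∈? Gb h) {xs = allFin (size G)} g∈) , x∈p

  ∣composeBags∣≤∣bag∣* : ∀ {w} → (∀ g → ∣ Fb g ∣ ≤ w) → ∀ h → ∣ composeBags F G H Fb Gb h ∣ ≤ ∣ Gb h ∣ * w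
  ∣composeBags∣≤∣bag∣* {w} ∣Fb∣≤w h = begin
    ∣ composeBags F G H Fb Gb h ∣  ≤⟨ ∣⋃-map∣≤length* Fb ∣Fb∣≤w members ⟩
    length members * w             ≡⟨ cong (_* w) (length-filter-∈?-allFin (Gb h)) ⟩
    ∣ Gb h ∣ * w                   ∎
    where
    open ≤-Reasoning
    members : List (V G)
    members = filter (_∈? Gb h) (allFin (size G))

  composeBags-isDecomposition : IsDecomposition G F Fb → IsDecomposition H G Gb →
                                IsDecomposition H F (composeBags F G H Fb Gb)
  composeBags-isDecomposition decompF decompG .D1 x with D1 decompF x
  ... | g , x∈g with D1 decompG g
  ...   | h , g∈h = h , ∈-composeBags⁺ (g , g∈h , x∈g)
  composeBags-isDecomposition decompF decompG .D2 x x′ x~x′ with D2 decompF x x′ x~x′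
  ... | inj₁ (g , x∈g , x′∈g) with D1 decompG g
  ...   | h , g∈h = inj₁ (h , ∈-composeBags⁺ (g , g∈h , x∈g) , ∈-composeBags⁺ (g , g∈h , x′∈g))
  composeBags-isDecomposition decompF decompG .D2 x x′ x~x′ | inj₂ (g , g′ , g~g′ , x∈g , x′∈g′)
    with D2 decompG g g′ g~g′
  ... | inj₁ (h , g∈h , g′∈h) =
    inj₁ (h , ∈-composeBags⁺ (g , g∈h , x∈g) , ∈-composeBags⁺ (g′ , g′∈h , x′∈g′))
  ... | inj₂ (h , h′ , h~h′ , g∈h , g′∈h′) =
    inj₂ (h , h′ , h~h′ , ∈-composeBags⁺ (g , g∈h , x∈g) , ∈-composeBags⁺ (g′ , g′∈h′ , x′∈g′))
  composeBags-isDecomposition decompF decompG .D3 x h h′ x∈h x∈h′ = WalkIn-map ∈-composeBags⁺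
    (InducesConnected-Meets decompG (D3 decompF x) h h′ (∈-composeBags⁻ x∈h) (∈-composeBags⁻ x∈h′))

lemma1 : (F G H : Graph) (wGF wHG : ℕ)
         → IsDecompWidth G F wGF → IsDecompWidth H G wHG
         → (Fb : V G → Subset (size F)) → IsDecomposition G F Fb → width G F Fb ≡ wGF
         → (Gb : V H → Subset (size G)) → IsDecomposition H G Gb → width H G Gb ≡ wHG
         → IsDecomposition H F (composeBags F G H Fb Gb)
           × (∀ (h : V H) → ∣ composeBags F G H Fb Gb h ∣ ≤ wGF * wHG)
lemma1 F G H wGF wHG _ _ Fb decompF refl Gb decompG refl =
  composeBags-isDecomposition F G H Fb Gb decompF decompG , ∣composeBags∣≤width*width
  where
  open ≤-Reasoning
  ∣composeBags∣≤width*width : ∀ h → ∣ composeBags F G H Fb Gb h ∣ ≤ width G F Fb * width H G Gb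
  ∣composeBags∣≤width*width h = begin
    ∣ composeBags F G H Fb Gb h ∣  ≤⟨ ∣composeBags∣≤∣bag∣* F G H Fb Gb (∣bag∣≤width G F Fb) h ⟩
    ∣ Gb h ∣ * width G F Fb        ≤⟨ *-monoˡ-≤ (width G F Fb) (∣bag∣≤width H G Gb h) ⟩
    width H G Gb * width G F Fb   ≡⟨ *-comm (width H G Gb) (width G F Fb) ⟩
    width G F Fb * width H G Gb   ∎
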